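{- A contact-segment graph with clique number $\omega$ does not contain $K_{12\omega,12\omega}$ as a subgraph.
   Context: A contact-segment graph is the intersection graph of a finite family of segments in the plane such that any point belonging to two of the segments is an endpoint of at least one of them. -}

module Defs where

open import Level using (Level; _⊔_; suc)
open import Data.Nat as ℕ using (ℕ) renaming (_≤_ to _≤ℕ_; _*_ to _*ℕ_)
open import Data.Fin using (Fin)
open import Data.Product using (Σ; ∃; _×_; _,_)
open import Data.Sum using (_⊎_)
open import Relation.Nullary using (¬_)
open import Relation.Binary.PropositionalEquality using (_≡_; _≢_)
open import Relation.Binary.Structures using (IsStrictTotalOrder)
open import Algebra.Structures using (IsCommutativeRing)
open import Function.Definitions using (Injective)

-- An ordered field (with propositional equality).  The real numbers are a
-- model; quantifying over all ordered fields is the setting we use for "the plane".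
record OrderedField (c ℓ : Level) : Set (Level.suc (c ⊔ ℓ)) where
  infixl 6 _+_
  infixl 7 _*_
  infix 4 _<_ _≤_
  field
    Carrier : Set c
    _+_ _*_ : Carrier → Carrier → Carrier
    -_ : Carrier → Carrier
    0# 1# : Carrier
    _<_ : Carrier → Carrier → Set ℓ
    isCommutativeRing : IsCommutativeRing _≡_ _+_ _*_ -_ 0# 1#
    0≢1 : 0# ≢ 1#
    inverse : ∀ x → x ≢ 0# → ∃ λ y → x * y ≡ 1#
    isStrictTotalOrder : IsStrictTotalOrder _≡_ _<_
    +-mono-< : ∀ {x y} z → x < y → x + z < y + z
    *-pos : ∀ {x y} → 0# < x → 0# < y → 0# < x * y

  _≤_ : Carrier → Carrier → Set (c ⊔ ℓ)
  x ≤ y = (x < y) ⊎ (x ≡ y)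

  _-_ : Carrier → Carrier → Carrier
  x - y = x + (- y)

module Geometry {c ℓ} (F : OrderedField c ℓ) where
  open OrderedField F

  Point : Set c
  Point = Carrier × Carrier

  record Segment : Set c where
    constructor seg
    field
      end₁ end₂ : Point
  open Segment public

  NonDegenerate : Segment → Set c
  NonDegenerate s = end₁ s ≢ end₂ s

  _∈Seg_ : Point → Segment → Set (c ⊔ ℓ)
  (px , py) ∈Seg seg (ax , ay) (bx , by) =
    Σ Carrier λ t → (0# ≤ t) × (t ≤ 1#)
      × (px ≡ ax + t * (bx - ax)) × (py ≡ ay + t * (by - ay))

  IsEndpoint : Point → Segment → Set c
  IsEndpoint p s = (p ≡ end₁ s) ⊎ (p ≡ end₂ s)

  IsContactFamily : ∀ {n} → (Fin n → Segment) → Set (c ⊔ ℓ)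
  IsContactFamily {n} S =
    (∀ i → NonDegenerate (S i)) ×
    (∀ (i j : Fin n) → i ≢ j → ∀ p → p ∈Seg S i → p ∈Seg S j →
        IsEndpoint p (S i) ⊎ IsEndpoint p (S j))

  Adj : ∀ {n} → (Fin n → Segment) → Fin n → Fin n → Set (c ⊔ ℓ)
  Adj S i j = (i ≢ j) × ∃ λ p → (p ∈Seg S i) × (p ∈Seg S j)

module _ {a} {n : ℕ} (E : Fin n → Fin n → Set a) where

  HasClique : ℕ → Set a
  HasClique k = Σ (Fin k → Fin n) λ f → Injective _≡_ _≡_ f
                  × (∀ x y → x ≢ y → E (f x) (f y))

  IsCliqueNumber : ℕ → Set a
  IsCliqueNumber ω = HasClique ω × (∀ k → HasClique k → k ≤ℕ ω)

  -- K_{s,t} is a subgraph: injective maps of the two sides, every cross pair adjacent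
  -- (disjointness of the two sides follows from irreflexivity of E where applicable;
  --  we require it explicitly anyway)
  HasKst : ℕ → ℕ → Set a
  HasKst s t = Σ (Fin s → Fin n) λ A → Σ (Fin t → Fin n) λ B →
                 Injective _≡_ _≡_ A × Injective _≡_ _≡_ B
                 × (∀ x y → A x ≢ B y) × (∀ x y → E (A x) (B y))

-- Let segments A₁ … Aₘ and B₁ … Bₘ form a K_{m,m}.  For each crossing pair
-- (Aₓ, B_y) pick a common point; by the contact condition it is an endpoint
-- of Aₓ or of B_y.  Segments sharing a point are pairwise adjacent, so for a
-- fixed Aₓ at most ω of the B_y meet it at each of its two endpoints, and
-- symmetrically.  Counting the m² pairs gives m² ≤ 4mω, i.e. m ≤ 4ω < 12ω.
module Submission where

open import Defs
open import Data.Nat using (ℕ; _*_; _<_)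
open import Data.Fin using (Fin)
open import Relation.Nullary using (¬_)

open import Level using (Level)
open import Data.Bool using (true; false; if_then_else_)
open import Data.Nat using (zero; suc; _+_; _≤_; _≰_; z≤n; s≤s)
open import Data.Nat.Properties
  using ( ≤-refl; ≤-reflexive; ≤-trans; <⇒≱; +-mono-≤; m<m+n; +-identityʳ; *-identityʳ; *-assoc
        ; *-distribˡ-+; *-cancelˡ-≤; *-monoˡ-<; +-0-commutativeMonoid; module ≤-Reasoning )
open import Data.Fin using (zero; suc; fromℕ<)
open import Data.Fin.Properties using (suc-injective)
open import Data.Vec.Functional using (_∷_)
open import Data.Product using (Σ; _×_; _,_; proj₁; proj₂)
open import Data.Product.Properties using (≡-dec)
open import Data.Sum using (_⊎_)
open import Function using (_∘_)
open import Function.Definitions using (Injective)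
open import Relation.Binary.Definitions using (DecidableEquality)
open import Relation.Binary.Structures using (IsStrictTotalOrder)
open import Relation.Binary.PropositionalEquality
open import Relation.Nullary using (Dec; does; yes; no; _because_; _⊎-dec_)
open import Relation.Nullary.Negation using (contradiction)
open import Relation.Unary using (Pred; Decidable)
open import Algebra.Properties.CommutativeMonoid.Sum +-0-commutativeMonoid
  using (sum; sum-cong-≗; ∑-distrib-+; ∑-comm)

private
  variable
    p q : Level
    a m m′ : ℕ

sum-const : ∀ m a → sum {m} (λ _ → a) ≡ m * a
sum-const zero    a = refl
sum-const (suc m) a = cong (a +_) (sum-const m a)

sum-mono-≤ : {f g : Fin m → ℕ} → (∀ i → f i ≤ g i) → sum f ≤ sum g
sum-mono-≤ {zero}  f≤g = z≤n
sum-mono-≤ {suc m} f≤g = +-mono-≤ (f≤g zero) (sum-mono-≤ (f≤g ∘ suc))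

sum-≤-* : {f : Fin m → ℕ} → (∀ i → f i ≤ a) → sum f ≤ m * a
sum-≤-* {m} {a} f≤a = subst (_ ≤_) (sum-const m a) (sum-mono-≤ f≤a)

indicator : {P : Set p} → Dec P → ℕ
indicator P? = if does P? then 1 else 0

indicator-⊎ : {P : Set p} {Q : Set q} (P? : Dec P) (Q? : Dec Q) →
              indicator (P? ⊎-dec Q?) ≤ indicator P? + indicator Q?
indicator-⊎ (true  because _) _                 = s≤s z≤n
indicator-⊎ (false because _) (true  because _) = s≤s z≤n
indicator-⊎ (false because _) (false because _) = z≤n

⊎⇒1≤indicator+indicator : {P : Set p} {Q : Set q} (P? : Dec P) (Q? : Dec Q) →
                    P ⊎ Q → 1 ≤ indicator P? + indicator Q?
⊎⇒1≤indicator+indicator P? Q? P⊎Q = ≤-trans (indicator-yes (P? ⊎-dec Q?) P⊎Q) (indicator-⊎ P? Q?)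
  where
  indicator-yes : {A : Set p} (A? : Dec A) → A → 1 ≤ indicator A?
  indicator-yes (yes _) _ = ≤-refl
  indicator-yes (no ¬a) a = contradiction a ¬a

count : {P : Pred (Fin m) p} → Decidable P → ℕ
count P? = sum (indicator ∘ P?)

count-⊎ : {P : Pred (Fin m) p} {Q : Pred (Fin m) q} (P? : Decidable P) (Q? : Decidable Q) →
          count (λ i → P? i ⊎-dec Q? i) ≤ count P? + count Q?
count-⊎ P? Q? = ≤-trans (sum-mono-≤ (λ i → indicator-⊎ (P? i) (Q? i)))
                        (≤-reflexive (∑-distrib-+ (indicator ∘ P?) (indicator ∘ Q?)))

enumerate : {P : Pred (Fin m) p} (P? : Decidable P) →
            Σ (Fin (count P?) → Fin m) λ g → Injective _≡_ _≡_ g × (∀ i → P (g i))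
enumerate {zero} P? = (λ ()) , (λ { {()} }) , (λ ())
enumerate {suc m} {P = P} P? with enumerate (P? ∘ suc) | P? zero
... | g , g-inj , Pg | yes P0 = zero ∷ suc ∘ g , inj , P′
  where
  inj : Injective _≡_ _≡_ (zero ∷ suc ∘ g)
  inj {zero}  {zero}  _ = refl
  inj {suc i} {suc j} e = cong suc (g-inj (suc-injective e))
  P′ : ∀ i → P ((zero ∷ suc ∘ g) i)
  P′ zero    = P0
  P′ (suc i) = Pg i
... | g , g-inj , Pg | no _ = suc ∘ g , g-inj ∘ suc-injective , Pg

double-counting : {R : Fin m → Fin m′ → Set p} {C : Fin m → Fin m′ → Set q} →
                  (R? : ∀ x → Decidable (R x)) (C? : ∀ y → Decidable (λ x → C x y)) →
                  (∀ x y → R x y ⊎ C x y) →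
                  m * m′ ≤ sum (λ x → count (R? x)) + sum (λ y → count (C? y))
double-counting {m} {m′} R? C? cover = begin
  m * m′                                          ≡⟨ sum-const m m′ ⟨
  sum {m} (λ _ → m′)                              ≡⟨ sum-cong-≗ {m} (λ _ → trans (sum-const m′ 1) (*-identityʳ m′)) ⟨
  sum {m} (λ _ → sum {m′} (λ _ → 1))              ≤⟨ sum-mono-≤ (λ x → sum-mono-≤ λ y →
                                                       ⊎⇒1≤indicator+indicator (R? x y) (C? y x) (cover x y)) ⟩
  sum (λ x → sum (λ y → r x y + c x y))           ≡⟨ sum-cong-≗ (λ x → ∑-distrib-+ (r x) (λ y → c x y)) ⟩
  sum (λ x → count (R? x) + sum (λ y → c x y))    ≡⟨ ∑-distrib-+ (λ x → count (R? x)) _ ⟩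
  sum (λ x → count (R? x)) + sum (λ x → sum (c x)) ≡⟨ cong (_ +_) (∑-comm c) ⟩
  sum (λ x → count (R? x)) + sum (λ y → count (C? y)) ∎
  where
  open ≤-Reasoning
  r c : Fin m → Fin m′ → ℕ
  r x y = indicator (R? x y)
  c x y = indicator (C? y x)

m*m≤m*a+m*a⇒m≤2*a : ∀ m a → m * m ≤ m * a + m * a → m ≤ 2 * a
m*m≤m*a+m*a⇒m≤2*a zero      a _ = z≤n
m*m≤m*a+m*a⇒m≤2*a m@(suc _) a m²≤ = *-cancelˡ-≤ m (begin
  m * m           ≤⟨ m²≤ ⟩
  m * a + m * a   ≡⟨ *-distribˡ-+ m a a ⟨
  m * (a + a)     ≡⟨ cong (λ t → m * (a + t)) (+-identityʳ a) ⟨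
  m * (2 * a)     ∎)
  where open ≤-Reasoning

12*ω≰4*ω : ∀ ω → 0 < ω → 12 * ω ≰ 4 * ω
12*ω≰4*ω ω@(suc _) _ = <⇒≱ (*-monoˡ-< ω (m<m+n 4 {8} (s≤s z≤n)))

module ContactGraph {c ℓ} (F : OrderedField c ℓ) {n : ℕ} (S : Fin n → Geometry.Segment F) where
  open OrderedField F using (isStrictTotalOrder)
  open Geometry F

  _≟ₚ_ : DecidableEquality Point
  _≟ₚ_ = ≡-dec (IsStrictTotalOrder._≟_ isStrictTotalOrder) (IsStrictTotalOrder._≟_ isStrictTotalOrder)

  isEndpoint? : ∀ p s → Dec (IsEndpoint p s)
  isEndpoint? p s = (p ≟ₚ end₁ s) ⊎-dec (p ≟ₚ end₂ s)

  common-point⇒clique : ∀ {k} (g : Fin k → Fin n) → Injective _≡_ _≡_ g →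
                        ∀ e → (∀ i → e ∈Seg S (g i)) → HasClique (Adj S) k
  common-point⇒clique g g-inj e e∈ = g , g-inj , λ i j i≢j → i≢j ∘ g-inj , e , e∈ i , e∈ j

  module _ {ω : ℕ} (isω : IsCliqueNumber (Adj S) ω) where

    clique-number-positive : 0 < n → 0 < ω
    clique-number-positive 0<n = proj₂ isω 1 singleton
      where
      singleton : HasClique (Adj S) 1
      singleton = (λ _ → fromℕ< 0<n)
                , (λ { {zero} {zero} _ → refl })
                , (λ { zero zero 0≢0 → contradiction refl 0≢0 })

    count-through-point≤ω : {P : Pred (Fin m) p} (P? : Decidable P) →
                            (g : Fin m → Fin n) → Injective _≡_ _≡_ g →
                            ∀ e → (∀ i → P i → e ∈Seg S (g i)) → count P? ≤ ω
    count-through-point≤ω P? g g-inj e P⇒e∈ with enumerate P?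
    ... | h , h-inj , Ph =
      proj₂ isω _ (common-point⇒clique (g ∘ h) (h-inj ∘ g-inj) e (λ i → P⇒e∈ (h i) (Ph i)))

    count-at-endpoint≤2ω : (pt : Fin m → Point) → (g : Fin m → Fin n) → Injective _≡_ _≡_ g →
                           (∀ i → pt i ∈Seg S (g i)) →
                           ∀ s → count (λ i → isEndpoint? (pt i) s) ≤ 2 * ω
    count-at-endpoint≤2ω pt g g-inj pt∈ s = begin
      count (λ i → isEndpoint? (pt i) s)                                ≤⟨ count-⊎ (λ i → pt i ≟ₚ end₁ s) (λ i → pt i ≟ₚ end₂ s) ⟩
      count (λ i → pt i ≟ₚ end₁ s) + count (λ i → pt i ≟ₚ end₂ s)     ≤⟨ +-mono-≤ (through end₁) (through end₂) ⟩
      ω + ω                                                             ≡⟨ cong (ω +_) (+-identityʳ ω) ⟨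
      2 * ω                                                             ∎
      where
      open ≤-Reasoning
      through : (end : Segment → Point) → count (λ i → pt i ≟ₚ end s) ≤ ω
      through end = count-through-point≤ω (λ i → pt i ≟ₚ end s) g g-inj (end s) λ i pt≡ → subst (_∈Seg S (g i)) pt≡ (pt∈ i)

    Kst⇒s*t≤s*2ω+t*2ω : ∀ {s t} → IsContactFamily S → HasKst (Adj S) s t →
                     s * t ≤ s * (2 * ω) + t * (2 * ω)
    Kst⇒s*t≤s*2ω+t*2ω {s} {t} (_ , contact) (A , B , A-inj , B-inj , _ , adj) = begin
      s * t                                                                ≤⟨ double-counting R? C? cover ⟩
      sum (λ x → count (R? x)) + sum (λ y → count (C? y))                  ≤⟨ +-mono-≤ (sum-≤-* rows) (sum-≤-* columns) ⟩
      s * (2 * ω) + t * (2 * ω)                                            ∎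
      where
      open ≤-Reasoning
      pt : Fin s → Fin t → Point
      pt x y = proj₁ (proj₂ (adj x y))
      pt∈A : ∀ x y → pt x y ∈Seg S (A x)
      pt∈A x y = proj₁ (proj₂ (proj₂ (adj x y)))
      pt∈B : ∀ x y → pt x y ∈Seg S (B y)
      pt∈B x y = proj₂ (proj₂ (proj₂ (adj x y)))
      R? : ∀ x y → Dec (IsEndpoint (pt x y) (S (A x)))
      R? x y = isEndpoint? (pt x y) (S (A x))
      C? : ∀ y x → Dec (IsEndpoint (pt x y) (S (B y)))
      C? y x = isEndpoint? (pt x y) (S (B y))
      cover : ∀ x y → IsEndpoint (pt x y) (S (A x)) ⊎ IsEndpoint (pt x y) (S (B y))
      cover x y = contact (A x) (B y) (proj₁ (adj x y)) (pt x y) (pt∈A x y) (pt∈B x y)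
      rows : ∀ x → count (R? x) ≤ 2 * ω
      rows x = count-at-endpoint≤2ω (pt x) B B-inj (pt∈B x) (S (A x))
      columns : ∀ y → count (C? y) ≤ 2 * ω
      columns y = count-at-endpoint≤2ω (λ x → pt x y) A A-inj (λ x → pt∈A x y) (S (B y))

lemma70 : ∀ {c ℓ} (F : OrderedField c ℓ) (n : ℕ) (S : Fin n → Geometry.Segment F)
    → 0 < n
    → Geometry.IsContactFamily F S
    → (ω : ℕ) → IsCliqueNumber (Geometry.Adj F S) ω
    → ¬ HasKst (Geometry.Adj F S) (12 * ω) (12 * ω)
lemma70 F n S 0<n contact ω isω K₁₂ω = 12*ω≰4*ω ω (clique-number-positive isω 0<n) (begin
  12 * ω          ≤⟨ m*m≤m*a+m*a⇒m≤2*a (12 * ω) (2 * ω) (Kst⇒s*t≤s*2ω+t*2ω isω contact K₁₂ω) ⟩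
  2 * (2 * ω)     ≡⟨ *-assoc 2 2 ω ⟨
  4 * ω           ∎)
  where
  open ContactGraph F S
  open ≤-Reasoning
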